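{- For every integer $n \ge 3$, the minimal size $\mathcal{M}(\mathrm{P}_n)$ of a maximal matching of the permutahedron graph $\mathrm{P}_n$ satisfies \[ \frac{n-1}{3n-2}\, n! \;\le\; \mathcal{M}(\mathrm{P}_n) \;\le\; \frac{1}{3}\, n!. \]
   Context: For a finite graph $G$, a matching is a set of edges no two of which share a vertex, and a maximal matching is a matching maximal with respect to inclusion; $\mathcal{M}(G)$ denotes the minimum cardinality of a maximal matching of $G$. The permutahedron $\mathrm{P}_n$ is the graph whose vertices are the permutations of $[n]=\{1,\dots,n\}$ (written in one-line notation $\sigma_1\dots\sigma_n$), two permutations being adjacent if one is obtained from the other by swapping the entries at two consecutive positions $i, i+1$ for some $i \in [n-1]$ (i.e. $\sigma' = \sigma\tau_i$ with $\tau_i$ the simple transposition $(i\ i+1)$). -}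

module Defs where

open import Data.Nat using (ℕ; suc)
open import Data.Fin using (Fin; toℕ; _≟_)
open import Data.Vec using (Vec; lookup; tabulate)
open import Data.List using (List; []; _∷_; concatMap; length)
open import Data.List.Relation.Unary.Unique.Propositional using (Unique)
open import Data.List.Membership.Propositional using (_∈_)
open import Data.Product using (Σ; _×_; _,_)
open import Data.Sum using (_⊎_)
open import Relation.Binary.PropositionalEquality using (_≡_)
open import Relation.Nullary using (yes; no)

-- A word of length n over [n] = Fin n, in one-line notation σ₁…σₙ.
Word : ℕ → Set
Word n = Vec (Fin n) n

-- σ is a permutation of [n] (an injective map Fin n → Fin n, hence bijective).
IsPerm : ∀ {n} → Word n → Set
IsPerm {n} σ = (i j : Fin n) → lookup σ i ≡ lookup σ j → i ≡ j

swapAt : ∀ {n} → Fin n → Fin n → Word n → Word n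
swapAt p q σ = tabulate f
  where
  f : _ → _
  f k with k ≟ p
  ... | yes _ = lookup σ q
  ... | no _ with k ≟ q
  ...   | yes _ = lookup σ p
  ...   | no _ = lookup σ k

Adj : ∀ {n} → Word n → Word n → Set
Adj {n} σ σ' = Σ (Fin n) λ p → Σ (Fin n) λ q →
  (toℕ q ≡ suc (toℕ p)) × (σ' ≡ swapAt p q σ)

Edge : ℕ → Set
Edge n = Word n × Word n

IsEdge : ∀ {n} → Edge n → Set
IsEdge (u , v) = IsPerm u × Adj u v

endpoints : ∀ {n} → List (Edge n) → List (Word n)
endpoints = concatMap (λ { (u , v) → u ∷ v ∷ [] })

-- A matching: a list of edges of P_n whose endpoints are pairwise distinct
-- (so no two edges share a vertex, and each edge is listed only once).
-- Its cardinality is the length of the list.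
IsMatching : ∀ {n} → List (Edge n) → Set
IsMatching {n} M = ((e : Edge n) → e ∈ M → IsEdge e) × Unique (endpoints M)

IsMaximalMatching : ∀ {n} → List (Edge n) → Set
IsMaximalMatching {n} M = IsMatching M ×
  ((e : Edge n) → IsEdge e →
     let (u , v) = e in (u ∈ endpoints M) ⊎ (v ∈ endpoints M))

IsMinMaximalMatchingSize : ℕ → ℕ → Set
IsMinMaximalMatchingSize n m =
  (Σ (List (Edge n)) λ M → IsMaximalMatching M × length M ≡ m) ×
  ((M : List (Edge n)) → IsMaximalMatching M → m Data.Nat.≤ length M)

-- Let M be a maximal matching of Pₙ and m = n − 1. Charge every pair (σ, j) of a
-- permutation and a position j < m to an edge of M: a matched σ charges its own edge, an unmatched σ
-- the edge covering its neighbour σ τⱼ, which exists by maximality. An edge u, u τᵢ receives at most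
-- 3m + 1 charges, because the unmatched vertices u τⱼ and u τᵢ τⱼ (|i − j| ≥ 2) cannot both charge it:
-- they are adjacent on the 4-cycle u, u τᵢ, u τᵢ τⱼ, u τⱼ. Hence m · n! ≤ (3m + 1) |M|.
--
-- Let c₀, c₁, … count, for each entry of σ, the smaller entries to its left; their sum is
-- the number of non-inversions, which every adjacent transposition changes by exactly one. Call σ
-- exposed if this sum is congruent mod 3 to a weight depending only on (c₁, c₂), i.e. on the pattern of
-- the first three entries. The weight is chosen so that the change by one is never compensated, hence
-- no two exposed permutations are adjacent. The transpositions τ₀, τ₁ cut Pₙ into hexagons, each with
-- exactly two opposite exposed vertices; matching the other four vertices along two hexagon edges
-- gives n!/3 edges, and the matching is maximal because every edge has an endpoint that is not exposed.
--
-- Maximal matchings of a given size can be enumerated, so the least size exists.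

module Submission where

open import Defs
open import Data.Nat using (ℕ; zero; suc; _+_; _*_; _∸_; _≤_; _<_; _≤?_; _!; z≤n; s≤s)
open import Data.Nat.Induction using (<-rec)
open import Data.Nat.ListAction using (sum)
open import Data.Nat.Properties as ℕ using (anyUpTo?; ≮⇒≥; 1+n≢n)
open import Data.Fin using (Fin; zero; suc; toℕ; inject₁; punchIn; punchOut) renaming (_<_ to _<ᶠ_)
open import Data.Fin.Properties using (_≟_; all?; any?; _<?_; <-cmp; <-asym; toℕ-injective; toℕ-inject₁; injective⇒≤; punchIn-injective; punchInᵢ≢i; punchOut-injective; punchIn-punchOut; suc-injective) renaming (<-trans to <ᶠ-trans)
open import Data.Vec using (Vec; []; _∷_; lookup; map; tabulate)
open import Data.Vec.Properties using (≡-dec; lookup-map; lookup∘tabulate; tabulate∘lookup; tabulate-cong; ∷-injectiveˡ; ∷-injectiveʳ)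
open import Data.List as List using (List; []; _∷_; length; concatMap; filter; cartesianProduct; cartesianProductWith; allFin)
open import Data.List.Effectful using (module MonadProperties)
import Data.List.Properties as Listₚ
open import Data.List.Properties using (length-map; length-++; length-tabulate)
import Data.List.Relation.Binary.Permutation.Propositional as ↭
open ↭ using (_↭_)
open import Data.List.Relation.Unary.Any as Any using (here; there; index)
open import Data.List.Relation.Unary.Any.Properties using (lookup-index)
open import Data.List.Relation.Unary.All as All using (All; []; _∷_)
open import Data.List.Relation.Unary.AllPairs using ([]; _∷_)
open import Data.List.Relation.Unary.Unique.Propositional using (Unique)
open import Data.List.Relation.Unary.Unique.Propositional.Properties using (++⁺; map⁺; filter⁺; cartesianProduct⁺; cartesianProductWith⁺; allFin⁺)
open import Data.List.Membership.Propositional using (_∈_; find; lose)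
open import Data.List.Membership.Propositional.Properties using (∈-lookup; ∈-allFin; ∈-map⁺; ∈-map⁻; ∈-filter⁺; ∈-filter⁻; ∈-concatMap⁺; ∈-concatMap⁻; ∈-cartesianProduct⁺; ∈-cartesianProduct⁻; ∈-cartesianProductWith⁺; ∈-cartesianProductWith⁻)
open import Data.Product using (Σ; ∃-syntax; _×_; _,_; proj₁; proj₂)
open import Data.Sum using (_⊎_; inj₁; inj₂)
open import Data.Empty using (⊥; ⊥-elim)
open import Data.Unit using (⊤; tt)
open import Function.Base using (_∘_)
open import Function.Definitions using (Injective)
open import Relation.Binary.PropositionalEquality using (module ≡-Reasoning; _≡_; _≢_; refl; sym; trans; cong; cong₂; subst; subst₂)
open import Relation.Binary.Definitions using (DecidableEquality; tri<; tri≈; tri>)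
open import Relation.Nullary using (¬_; Dec; yes; no)
open import Relation.Nullary.Decidable using (_×-dec_; _⊎-dec_; _→-dec_; map′)
open import Relation.Unary using (Decidable)
open import Algebra.Properties.CommutativeSemigroup ℕ.+-commutativeSemigroup using (x∙yz≈y∙xz)

Unique⇒lookup-injective : ∀ {A : Set} {xs : List A} → Unique xs → Injective _≡_ _≡_ (List.lookup xs)
Unique⇒lookup-injective {xs = x ∷ xs} _          {zero}  {zero}  _  = refl
Unique⇒lookup-injective {xs = x ∷ xs} (x∉xs ∷ _) {zero}  {suc j} eq = ⊥-elim (All.lookup x∉xs (∈-lookup j) eq)
Unique⇒lookup-injective {xs = x ∷ xs} (x∉xs ∷ _) {suc i} {zero}  eq = ⊥-elim (All.lookup x∉xs (∈-lookup i) (sym eq))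
Unique⇒lookup-injective {xs = x ∷ xs} (_ ∷ uniq) {suc i} {suc j} eq = cong suc (Unique⇒lookup-injective uniq eq)

injectiveRelation⇒length≤ : ∀ {A B : Set} (R : A → B → Set) {D : List A} {C : List B} → Unique D →
  (∀ {d} → d ∈ D → ∃[ c ] c ∈ C × R d c) →
  (∀ {d d′ c} → d ∈ D → d′ ∈ D → R d c → R d′ c → d ≡ d′) →
  length D ≤ length C
injectiveRelation⇒length≤ {B = B} R {D} {C} uniqueD image functional = injective⇒≤ position-injective
  where
  target : Fin (length D) → B
  target i = proj₁ (image (∈-lookup i))

  target-∈ : ∀ i → target i ∈ C
  target-∈ i = proj₁ (proj₂ (image (∈-lookup i)))

  related : ∀ i → R (List.lookup D i) (target i)
  related i = proj₂ (proj₂ (image (∈-lookup i)))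

  position-injective : Injective _≡_ _≡_ (λ i → index (target-∈ i))
  position-injective {i} {j} eq = Unique⇒lookup-injective uniqueD
    (functional (∈-lookup i) (∈-lookup j) (related i) (subst (R _) (sym same-target) (related j)))
    where
    same-target : target i ≡ target j
    same-target = trans (lookup-index (target-∈ i))
                        (trans (cong (List.lookup C) eq) (sym (lookup-index (target-∈ j))))

length-allFin : ∀ n → length (allFin n) ≡ n
length-allFin n = length-tabulate (λ i → i)

length-cartesianProductWith : ∀ {A B C : Set} (f : A → B → C) xs ys →
  length (cartesianProductWith f xs ys) ≡ length xs * length ys
length-cartesianProductWith f []       ys = refl
length-cartesianProductWith f (x ∷ xs) ys =
  trans (length-++ (List.map (f x) ys)) (cong₂ _+_ (length-map (f x) ys) (length-cartesianProductWith f xs ys))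

length-concatMap : ∀ {A B : Set} (f : A → List B) {c} → (∀ x → length (f x) ≡ c) →
  ∀ xs → length (concatMap f xs) ≡ c * length xs
length-concatMap f {c} len []       = sym (ℕ.*-zeroʳ c)
length-concatMap f {c} len (x ∷ xs) =
  trans (length-++ (f x)) (trans (cong₂ _+_ (len x) (length-concatMap f len xs)) (sym (ℕ.*-suc c (length xs))))

Unique-concatMap : ∀ {A B : Set} (f : A → List B) {xs} → Unique xs → (∀ {x} → x ∈ xs → Unique (f x)) →
  (∀ {x x′ y} → x ∈ xs → x′ ∈ xs → y ∈ f x → y ∈ f x′ → x ≡ x′) → Unique (concatMap f xs)
Unique-concatMap f {[]}     _             _        _        = []
Unique-concatMap f {x ∷ xs} (x∉xs ∷ uniq) f-unique disjoint =
  ++⁺ (f-unique (here refl)) (Unique-concatMap f uniq (f-unique ∘ there) (λ p q → disjoint (there p) (there q))) separated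
  where
  separated : ∀ {y} → ¬ (y ∈ f x × y ∈ concatMap f xs)
  separated (y∈fx , y∈rest) with x′ , x′∈xs , y∈fx′ ← find (∈-concatMap⁻ f {xs = xs} y∈rest) =
    All.lookup x∉xs x′∈xs (disjoint (here refl) (there x′∈xs) y∈fx y∈fx′)

map-injective : ∀ {A B : Set} {f : A → B} → Injective _≡_ _≡_ f → ∀ {l} → Injective _≡_ _≡_ (map {n = l} f)
map-injective f-inj {x = []}    {[]}    _  = refl
map-injective f-inj {x = x ∷ u} {y ∷ v} eq = cong₂ _∷_ (f-inj (∷-injectiveˡ eq)) (map-injective f-inj (∷-injectiveʳ eq))

lookup-extensionality : ∀ {A : Set} {n} {u v : Vec A n} → (∀ k → lookup u k ≡ lookup v k) → u ≡ v
lookup-extensionality {u = u} {v} eq = trans (sym (tabulate∘lookup u)) (trans (tabulate-cong eq) (tabulate∘lookup v))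

extend : ∀ {n} → Fin (suc n) → Word n → Word (suc n)
extend k σ = k ∷ map (punchIn k) σ

extend-injective : ∀ {n} {k k′ : Fin (suc n)} {σ σ′ : Word n} → extend k σ ≡ extend k′ σ′ → k ≡ k′ × σ ≡ σ′
extend-injective {k = k} eq with refl ← ∷-injectiveˡ eq = refl , map-injective (punchIn-injective k _ _) (∷-injectiveʳ eq)

IsPerm-extend : ∀ {n} k (σ : Word n) → IsPerm σ → IsPerm (extend k σ)
IsPerm-extend k σ σ-perm = injective
  where
  entry : ∀ i → lookup (map (punchIn k) σ) i ≡ punchIn k (lookup σ i)
  entry i = lookup-map i (punchIn k) σ

  injective : IsPerm (extend k σ)
  injective zero    zero    _  = refl
  injective zero    (suc j) eq = ⊥-elim (punchInᵢ≢i k (lookup σ j) (sym (trans eq (entry j))))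
  injective (suc i) zero    eq = ⊥-elim (punchInᵢ≢i k (lookup σ i) (trans (sym (entry i)) eq))
  injective (suc i) (suc j) eq =
    cong suc (σ-perm i j (punchIn-injective k _ _ (trans (sym (entry i)) (trans eq (entry j)))))

permutations : ∀ n → List (Word n)
permutations zero    = [] ∷ []
permutations (suc n) = cartesianProductWith extend (allFin (suc n)) (permutations n)

length-permutations : ∀ n → length (permutations n) ≡ n !
length-permutations zero    = refl
length-permutations (suc n) =
  trans (length-cartesianProductWith extend (allFin (suc n)) (permutations n))
        (cong₂ _*_ (length-allFin (suc n)) (length-permutations n))

permutations-unique : ∀ n → Unique (permutations n)
permutations-unique zero    = [] ∷ []
permutations-unique (suc n) =
  cartesianProductWith⁺ extend extend-injective (allFin⁺ (suc n)) (permutations-unique n)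

∈-permutations⁻ : ∀ n {σ} → σ ∈ permutations n → IsPerm σ
∈-permutations⁻ zero    {[]} _ ()
∈-permutations⁻ (suc n) σ∈
  with k , τ , _ , τ∈ , refl ← ∈-cartesianProductWith⁻ extend (allFin (suc n)) (permutations n) σ∈ =
  IsPerm-extend k τ (∈-permutations⁻ n τ∈)

module _ {n : ℕ} {k : Fin (suc n)} {rest : Vec (Fin (suc n)) n} (perm : IsPerm (k ∷ rest)) where

  private
    head∉rest : ∀ i → k ≢ lookup rest i
    head∉rest i eq with () ← perm zero (suc i) eq

  restrict : Word n
  restrict = tabulate (λ i → punchOut (head∉rest i))

  private
    lookup-restrict : ∀ i → lookup restrict i ≡ punchOut (head∉rest i)
    lookup-restrict = lookup∘tabulate (λ i → punchOut (head∉rest i))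

  IsPerm-restrict : IsPerm restrict
  IsPerm-restrict i j eq = suc-injective (perm (suc i) (suc j)
    (punchOut-injective (head∉rest i) (head∉rest j) (trans (sym (lookup-restrict i)) (trans eq (lookup-restrict j)))))

  extend-restrict : extend k restrict ≡ k ∷ rest
  extend-restrict = cong (k ∷_) (lookup-extensionality entry)
    where
    entry : ∀ i → lookup (map (punchIn k) restrict) i ≡ lookup rest i
    entry i = trans (lookup-map i (punchIn k) restrict)
                    (trans (cong (punchIn k) (lookup-restrict i)) (punchIn-punchOut (head∉rest i)))

∈-permutations⁺ : ∀ n {σ : Word n} → IsPerm σ → σ ∈ permutations n
∈-permutations⁺ zero    {[]}       _    = here refl
∈-permutations⁺ (suc n) {k ∷ rest} perm = subst (_∈ permutations (suc n)) (extend-restrict perm)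
  (∈-cartesianProductWith⁺ extend (∈-allFin k) (∈-permutations⁺ n (IsPerm-restrict perm)))

swap : ∀ {A : Set} {m} → Fin m → Vec A (suc m) → Vec A (suc m)
swap zero    (a ∷ b ∷ v) = b ∷ a ∷ v
swap (suc i) (a ∷ v)     = a ∷ swap i v

module _ {A : Set} where

  swap-involutive : ∀ {m} (i : Fin m) (v : Vec A (suc m)) → swap i (swap i v) ≡ v
  swap-involutive zero    (a ∷ b ∷ v) = refl
  swap-involutive (suc i) (a ∷ v)     = cong (a ∷_) (swap-involutive i v)

  swap-injective : ∀ {m} (i : Fin m) {v w : Vec A (suc m)} → swap i v ≡ swap i w → v ≡ w
  swap-injective i {v} {w} eq = trans (sym (swap-involutive i v)) (trans (cong (swap i) eq) (swap-involutive i w))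

  swap-unswap : ∀ {m} (i : Fin m) {v w : Vec A (suc m)} → swap i v ≡ w → v ≡ swap i w
  swap-unswap i {v} refl = sym (swap-involutive i v)

  lookup-swap-inject₁ : ∀ {m} (i : Fin m) (v : Vec A (suc m)) → lookup (swap i v) (inject₁ i) ≡ lookup v (suc i)
  lookup-swap-inject₁ zero    (a ∷ b ∷ v) = refl
  lookup-swap-inject₁ (suc i) (a ∷ v)     = lookup-swap-inject₁ i v

  lookup-swap-suc : ∀ {m} (i : Fin m) (v : Vec A (suc m)) → lookup (swap i v) (suc i) ≡ lookup v (inject₁ i)
  lookup-swap-suc zero    (a ∷ b ∷ v) = refl
  lookup-swap-suc (suc i) (a ∷ v)     = lookup-swap-suc i v

  lookup-swap-other : ∀ {m} (i : Fin m) (v : Vec A (suc m)) {k} →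
    k ≢ inject₁ i → k ≢ suc i → lookup (swap i v) k ≡ lookup v k
  lookup-swap-other zero    (a ∷ b ∷ v) {zero}        k≢i _     = ⊥-elim (k≢i refl)
  lookup-swap-other zero    (a ∷ b ∷ v) {suc zero}    _   k≢i+1 = ⊥-elim (k≢i+1 refl)
  lookup-swap-other zero    (a ∷ b ∷ v) {suc (suc k)} _   _     = refl
  lookup-swap-other (suc i) (a ∷ v)     {zero}        _   _     = refl
  lookup-swap-other (suc i) (a ∷ v)     {suc k}       k≢i k≢i+1 =
    lookup-swap-other i v (k≢i ∘ cong suc) (k≢i+1 ∘ cong suc)

swapIndex : ∀ {m} → Fin m → Fin (suc m) → Fin (suc m)
swapIndex zero    zero          = suc zero
swapIndex zero    (suc zero)    = zero
swapIndex zero    (suc (suc k)) = suc (suc k)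
swapIndex (suc i) zero          = zero
swapIndex (suc i) (suc k)       = suc (swapIndex i k)

swapIndex-involutive : ∀ {m} (i : Fin m) k → swapIndex i (swapIndex i k) ≡ k
swapIndex-involutive zero    zero          = refl
swapIndex-involutive zero    (suc zero)    = refl
swapIndex-involutive zero    (suc (suc k)) = refl
swapIndex-involutive (suc i) zero          = refl
swapIndex-involutive (suc i) (suc k)       = cong suc (swapIndex-involutive i k)

lookup-swap : ∀ {A : Set} {m} (i : Fin m) (v : Vec A (suc m)) k → lookup (swap i v) k ≡ lookup v (swapIndex i k)
lookup-swap zero    (a ∷ b ∷ v) zero          = refl
lookup-swap zero    (a ∷ b ∷ v) (suc zero)    = refl
lookup-swap zero    (a ∷ b ∷ v) (suc (suc k)) = refl
lookup-swap (suc i) (a ∷ v)     zero          = refl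
lookup-swap (suc i) (a ∷ v)     (suc k)       = lookup-swap i v k

IsPerm-swap : ∀ {m} (i : Fin m) (σ : Word (suc m)) → IsPerm σ → IsPerm (swap i σ)
IsPerm-swap i σ σ-perm a b eq = begin
  a                            ≡⟨ swapIndex-involutive i a ⟨
  swapIndex i (swapIndex i a)  ≡⟨ cong (swapIndex i) (σ-perm _ _ entries) ⟩
  swapIndex i (swapIndex i b)  ≡⟨ swapIndex-involutive i b ⟩
  b                            ∎
  where
  open ≡-Reasoning

  entries : lookup σ (swapIndex i a) ≡ lookup σ (swapIndex i b)
  entries = trans (sym (lookup-swap i σ a)) (trans eq (lookup-swap i σ b))

inject₁≢suc : ∀ {m} (i : Fin m) → inject₁ i ≢ suc i
inject₁≢suc i eq = 1+n≢n (trans (sym (cong toℕ eq)) (toℕ-inject₁ i))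

-- swapAt's entry function is local to Defs; unification against tabulate gives it a name.
swapAt-tabulated : ∀ {n} (p q : Fin n) (σ : Word n) → Σ (Fin n → Fin n) λ f → swapAt p q σ ≡ tabulate f
swapAt-tabulated p q σ = _ , refl

module _ {n : ℕ} (p q : Fin n) (σ : Word n) where

  lookup-swapAt-first : lookup (swapAt p q σ) p ≡ lookup σ q
  lookup-swapAt-first rewrite lookup∘tabulate (proj₁ (swapAt-tabulated p q σ)) p with p ≟ p
  ... | yes _   = refl
  ... | no p≢p = ⊥-elim (p≢p refl)

  lookup-swapAt-second : p ≢ q → lookup (swapAt p q σ) q ≡ lookup σ p
  lookup-swapAt-second p≢q rewrite lookup∘tabulate (proj₁ (swapAt-tabulated p q σ)) q with q ≟ p
  ... | yes q≡p = ⊥-elim (p≢q (sym q≡p))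
  ... | no _ with q ≟ q
  ...   | yes _   = refl
  ...   | no q≢q = ⊥-elim (q≢q refl)

  lookup-swapAt-other : ∀ {k} → k ≢ p → k ≢ q → lookup (swapAt p q σ) k ≡ lookup σ k
  lookup-swapAt-other {k} k≢p k≢q rewrite lookup∘tabulate (proj₁ (swapAt-tabulated p q σ)) k with k ≟ p
  ... | yes k≡p = ⊥-elim (k≢p k≡p)
  ... | no _ with k ≟ q
  ...   | yes k≡q = ⊥-elim (k≢q k≡q)
  ...   | no _    = refl

swapAt-adjacent : ∀ {m} (i : Fin m) (σ : Word (suc m)) → swapAt (inject₁ i) (suc i) σ ≡ swap i σ
swapAt-adjacent i σ = lookup-extensionality entry
  where
  entry : ∀ k → lookup (swapAt (inject₁ i) (suc i) σ) k ≡ lookup (swap i σ) k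
  entry k with k ≟ inject₁ i | k ≟ suc i
  ... | yes refl | _        =
    trans (lookup-swapAt-first (inject₁ i) (suc i) σ) (sym (lookup-swap-inject₁ i σ))
  ... | no _     | yes refl =
    trans (lookup-swapAt-second (inject₁ i) (suc i) σ (inject₁≢suc i)) (sym (lookup-swap-suc i σ))
  ... | no k≢i   | no k≢i+1 =
    trans (lookup-swapAt-other (inject₁ i) (suc i) σ k≢i k≢i+1) (sym (lookup-swap-other i σ k≢i k≢i+1))

Adj⇒swap : ∀ {m} {σ σ′ : Word (suc m)} → Adj σ σ′ → ∃[ i ] σ′ ≡ swap i σ
Adj⇒swap {σ = σ} (p , suc i , eq , refl)
  with refl ← toℕ-injective {i = p} {inject₁ i} (trans (sym (ℕ.suc-injective eq)) (sym (toℕ-inject₁ i)))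
  = i , swapAt-adjacent i σ

swap⇒Adj : ∀ {m} (i : Fin m) (σ : Word (suc m)) → Adj σ (swap i σ)
swap⇒Adj i σ = inject₁ i , suc i , cong suc (sym (toℕ-inject₁ i)) , sym (swapAt-adjacent i σ)

Far : ∀ {m} → Fin m → Fin m → Set
Far i j = toℕ j ≢ toℕ i × toℕ j ≢ suc (toℕ i) × suc (toℕ j) ≢ toℕ i

module _ {A : Set} where

  swap-comm : ∀ {m} (i j : Fin m) (v : Vec A (suc m)) → Far i j → swap j (swap i v) ≡ swap i (swap j v)
  swap-comm zero          zero          v           (j≢i , _ , _)   = ⊥-elim (j≢i refl)
  swap-comm zero          (suc zero)    v           (_ , j≢i+1 , _) = ⊥-elim (j≢i+1 refl)
  swap-comm zero          (suc (suc j)) (a ∷ b ∷ v) _               = refl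
  swap-comm (suc zero)    zero          v           (_ , _ , j+1≢i) = ⊥-elim (j+1≢i refl)
  swap-comm (suc (suc i)) zero          (a ∷ b ∷ v) _               = refl
  swap-comm (suc i)       (suc j)       (a ∷ v)     (j≢i , j≢i+1 , j+1≢i) =
    cong (a ∷_) (swap-comm i j v (j≢i ∘ cong suc , j≢i+1 ∘ cong suc , j+1≢i ∘ cong suc))

  swap-position-injective : ∀ {m} (i i′ : Fin m) (v : Vec A (suc m)) →
    Injective _≡_ _≡_ (lookup v) → swap i v ≡ swap i′ v → i ≡ i′
  swap-position-injective zero    zero     v           _     _  = refl
  swap-position-injective zero    (suc i′) (a ∷ b ∷ v) v-inj eq with () ← v-inj {zero} {suc zero} (sym (∷-injectiveˡ eq))
  swap-position-injective (suc i) zero     (a ∷ b ∷ v) v-inj eq with () ← v-inj {zero} {suc zero} (∷-injectiveˡ eq)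
  swap-position-injective (suc i) (suc i′) (a ∷ v)     v-inj eq =
    cong suc (swap-position-injective i i′ v (suc-injective ∘ v-inj) (∷-injectiveʳ eq))

module _ {n : ℕ} where

  ∈-endpoints⁺ˡ : ∀ {e : Edge n} {M} → e ∈ M → proj₁ e ∈ endpoints M
  ∈-endpoints⁺ˡ (here refl) = here refl
  ∈-endpoints⁺ˡ (there e∈)  = there (there (∈-endpoints⁺ˡ e∈))

  ∈-endpoints⁺ʳ : ∀ {e : Edge n} {M} → e ∈ M → proj₂ e ∈ endpoints M
  ∈-endpoints⁺ʳ (here refl) = there (here refl)
  ∈-endpoints⁺ʳ (there e∈)  = there (there (∈-endpoints⁺ʳ e∈))

  ∈-endpoints⁻ : ∀ {σ : Word n} M → σ ∈ endpoints M → ∃[ e ] e ∈ M × (σ ≡ proj₁ e ⊎ σ ≡ proj₂ e)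
  ∈-endpoints⁻ (e ∷ M) (here refl)         = e , here refl , inj₁ refl
  ∈-endpoints⁻ (e ∷ M) (there (here refl)) = e , here refl , inj₂ refl
  ∈-endpoints⁻ (e ∷ M) (there (there σ∈))  with e′ , e′∈ , ends ← ∈-endpoints⁻ M σ∈ = e′ , there e′∈ , ends

  endpoints-concatMap : ∀ {A : Set} (f : A → List (Edge n)) xs →
    endpoints (concatMap f xs) ≡ concatMap (λ x → endpoints (f x)) xs
  endpoints-concatMap f xs = sym (MonadProperties.associative xs f _)

-- Lower bound

data SlotKind : Set where
  first second neighbour : SlotKind

data Slot (m : ℕ) : Set where
  slot  : SlotKind → Fin m → Slot m
  extra : Slot m

slots : ∀ m → List (Slot m)
slots m = extra ∷ cartesianProductWith slot (first ∷ second ∷ neighbour ∷ []) (allFin m)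

length-slots : ∀ m → length (slots m) ≡ suc (3 * m)
length-slots m = cong suc (trans (length-cartesianProductWith slot (first ∷ second ∷ neighbour ∷ []) (allFin m))
                                 (cong (3 *_) (length-allFin m)))

∈-slots : ∀ {m} (s : Slot m) → s ∈ slots m
∈-slots extra      = here refl
∈-slots (slot k j) = there (∈-cartesianProductWith⁺ slot (kind∈ k) (∈-allFin j))
  where
  kind∈ : ∀ k → k ∈ first ∷ second ∷ neighbour ∷ []
  kind∈ first     = here refl
  kind∈ second    = there (here refl)
  kind∈ neighbour = there (there (here refl))

module LowerBound {m : ℕ} {M : List (Edge (suc m))} (maximal : IsMaximalMatching M) where

  private
    n : ℕ
    n = suc m

    open import Data.List.Membership.DecPropositional (≡-dec {n = n} (_≟_ {n})) using (_∈?_)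

    Matched : Word n → Set
    Matched σ = σ ∈ endpoints M

    edge : ∀ {e} → e ∈ M → IsEdge e
    edge {e} e∈ = proj₁ (proj₁ maximal) e e∈

    first-injective : ∀ {e} → e ∈ M → Injective _≡_ _≡_ (lookup (proj₁ e))
    first-injective e∈ = proj₁ (edge e∈) _ _

    cover : ∀ {σ} → IsPerm σ → ∀ j → Matched σ ⊎ Matched (swap j σ)
    cover {σ} σ-perm j = proj₂ maximal (σ , swap j σ) (σ-perm , swap⇒Adj j σ)

  data Charge : Word n × Fin m → Edge n × Slot m → Set where
    asFirst        : ∀ {σ j e} → e ∈ M → σ ≡ proj₁ e → Charge (σ , j) (e , slot first j)
    asSecond       : ∀ {σ j e} → e ∈ M → σ ≡ proj₂ e → Charge (σ , j) (e , slot second j)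
    viaFirst       : ∀ {σ j e} → e ∈ M → ¬ Matched σ → swap j σ ≡ proj₁ e → Charge (σ , j) (e , slot neighbour j)
    viaSecondFar   : ∀ {σ j e} i → e ∈ M → ¬ Matched σ → swap j σ ≡ proj₂ e → proj₂ e ≡ swap i (proj₁ e) →
                     Far i j → Charge (σ , j) (e , slot neighbour j)
    viaSecondAbove : ∀ {σ j e} i → e ∈ M → ¬ Matched σ → swap j σ ≡ proj₂ e → proj₂ e ≡ swap i (proj₁ e) →
                     toℕ j ≡ suc (toℕ i) → Charge (σ , j) (e , slot neighbour i)
    viaSecondBelow : ∀ {σ j e} i → e ∈ M → ¬ Matched σ → swap j σ ≡ proj₂ e → proj₂ e ≡ swap i (proj₁ e) →
                     suc (toℕ j) ≡ toℕ i → Charge (σ , j) (e , extra)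

  D : List (Word n × Fin m)
  D = cartesianProduct (permutations n) (allFin m)

  C : List (Edge n × Slot m)
  C = cartesianProduct M (slots m)

  private
    perm∈D : ∀ {σ j} → (σ , j) ∈ D → IsPerm σ
    perm∈D d∈ = ∈-permutations⁻ n (proj₁ (∈-cartesianProduct⁻ (permutations n) (allFin m) d∈))

    -- σ′ = σ τᵢ closes the 4-cycle u, u τᵢ, u τᵢ τⱼ, u τⱼ, and neither σ nor σ′ is matched.
    viaFirst-viaSecondFar : ∀ {σ σ′ j i e} → IsPerm σ → ¬ Matched σ → swap j σ ≡ proj₁ e →
      ¬ Matched σ′ → swap j σ′ ≡ proj₂ e → proj₂ e ≡ swap i (proj₁ e) → Far i j → ⊥
    viaFirst-viaSecondFar {σ} {σ′} {j} {i} {e} σ-perm σ∉ σj≡u σ′∉ σ′j≡v v≡ui far with cover σ-perm i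
    ... | inj₁ σ∈  = σ∉ σ∈
    ... | inj₂ σi∈ = σ′∉ (subst Matched (sym σ′≡σi) σi∈)
      where
      σ′≡σi : σ′ ≡ swap i σ
      σ′≡σi = begin
        σ′                         ≡⟨ swap-unswap j σ′j≡v ⟩
        swap j (proj₂ e)           ≡⟨ cong (swap j) v≡ui ⟩
        swap j (swap i (proj₁ e))  ≡⟨ swap-comm i j (proj₁ e) far ⟩
        swap i (swap j (proj₁ e))  ≡⟨ cong (swap i) (swap-unswap j σj≡u) ⟨
        swap i σ                   ∎
        where open ≡-Reasoning

    viaFirst-viaSecondAbove : ∀ {σ j e} → e ∈ M → ¬ Matched σ → swap j σ ≡ proj₁ e →
      proj₂ e ≡ swap j (proj₁ e) → ⊥
    viaFirst-viaSecondAbove {σ} {j} e∈ σ∉ σj≡u v≡uj =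
      σ∉ (subst Matched (sym (trans (swap-unswap j σj≡u) (sym v≡uj))) (∈-endpoints⁺ʳ e∈))

    viaSecondFar-viaSecondAbove : ∀ {j i e} → e ∈ M → proj₂ e ≡ swap i (proj₁ e) → Far i j →
      proj₂ e ≡ swap j (proj₁ e) → ⊥
    viaSecondFar-viaSecondAbove {j} {i} {e} e∈ v≡ui (j≢i , _) v≡uj =
      j≢i (cong toℕ (sym (swap-position-injective i j (proj₁ e) (first-injective e∈) (trans (sym v≡ui) v≡uj))))

  charge-functional : ∀ {d d′ c} → d ∈ D → d′ ∈ D → Charge d c → Charge d′ c → d ≡ d′
  charge-functional _ _ (asFirst _ σ≡) (asFirst _ σ′≡) = cong (_, _) (trans σ≡ (sym σ′≡))
  charge-functional _ _ (asSecond _ σ≡) (asSecond _ σ′≡) = cong (_, _) (trans σ≡ (sym σ′≡))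
  charge-functional _ _ (viaFirst {j = j} _ _ σj≡) (viaFirst _ _ σ′j≡) =
    cong (_, _) (swap-injective j (trans σj≡ (sym σ′j≡)))
  charge-functional d∈ _ (viaFirst _ σ∉ σj≡) (viaSecondFar _ _ σ′∉ σ′j≡ v≡ui far) =
    ⊥-elim (viaFirst-viaSecondFar (perm∈D d∈) σ∉ σj≡ σ′∉ σ′j≡ v≡ui far)
  charge-functional _ d′∈ (viaSecondFar _ _ σ∉ σj≡ v≡ui far) (viaFirst _ σ′∉ σ′j≡) =
    ⊥-elim (viaFirst-viaSecondFar (perm∈D d′∈) σ′∉ σ′j≡ σ∉ σj≡ v≡ui far)
  charge-functional _ _ (viaFirst e∈ σ∉ σj≡) (viaSecondAbove _ _ _ _ v≡uj _) =
    ⊥-elim (viaFirst-viaSecondAbove e∈ σ∉ σj≡ v≡uj)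
  charge-functional _ _ (viaSecondAbove _ _ _ _ v≡uj _) (viaFirst e∈ σ∉ σj≡) =
    ⊥-elim (viaFirst-viaSecondAbove e∈ σ∉ σj≡ v≡uj)
  charge-functional _ _ (viaSecondFar {j = j} _ _ _ σj≡ _ _) (viaSecondFar _ _ _ σ′j≡ _ _) =
    cong (_, _) (swap-injective j (trans σj≡ (sym σ′j≡)))
  charge-functional _ _ (viaSecondFar _ e∈ _ _ v≡ui far) (viaSecondAbove _ _ _ _ v≡uj _) =
    ⊥-elim (viaSecondFar-viaSecondAbove e∈ v≡ui far v≡uj)
  charge-functional _ _ (viaSecondAbove _ _ _ _ v≡uj _) (viaSecondFar _ e∈ _ _ v≡ui far) =
    ⊥-elim (viaSecondFar-viaSecondAbove e∈ v≡ui far v≡uj)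
  charge-functional _ _ (viaSecondAbove {j = j} _ _ _ σj≡ _ j≡i+1) (viaSecondAbove {j = j′} _ _ _ σ′j′≡ _ j′≡i+1)
    with refl ← toℕ-injective {i = j} {j′} (trans j≡i+1 (sym j′≡i+1)) =
    cong (_, _) (swap-injective j (trans σj≡ (sym σ′j′≡)))
  charge-functional _ _ (viaSecondBelow {j = j} {e} i e∈ _ σj≡ v≡ui j+1≡i)
                        (viaSecondBelow {j = j′} i′ _ _ σ′j′≡ v≡ui′ j′+1≡i′)
    with refl ← swap-position-injective i i′ (proj₁ e) (first-injective e∈) (trans (sym v≡ui) v≡ui′)
    with refl ← toℕ-injective {i = j} {j′} (ℕ.suc-injective (trans j+1≡i (sym j′+1≡i′))) =
    cong (_, _) (swap-injective j (trans σj≡ (sym σ′j′≡)))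

  private
    charged : ∀ {d e s} → e ∈ M → Charge d (e , s) → ∃[ c ] c ∈ C × Charge d c
    charged {s = s} e∈ ch = _ , ∈-cartesianProduct⁺ e∈ (∈-slots s) , ch

    chargeMatched : ∀ {σ} j → Matched σ → ∃[ c ] c ∈ C × Charge (σ , j) c
    chargeMatched j σ∈ with ∈-endpoints⁻ M σ∈
    ... | e , e∈ , inj₁ σ≡u = charged e∈ (asFirst e∈ σ≡u)
    ... | e , e∈ , inj₂ σ≡v = charged e∈ (asSecond e∈ σ≡v)

    chargeViaSecond : ∀ {σ j e} → e ∈ M → ¬ Matched σ → swap j σ ≡ proj₂ e → ∃[ c ] c ∈ C × Charge (σ , j) c
    chargeViaSecond {σ} {j} {e} e∈ σ∉ σj≡v with i , v≡ui ← Adj⇒swap (proj₂ (edge e∈)) | toℕ j ℕ.≟ toℕ i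
    ... | yes j≡i = ⊥-elim (σ∉ (subst Matched (sym σ≡u) (∈-endpoints⁺ˡ e∈)))
      where
      σ≡u : σ ≡ proj₁ e
      σ≡u = begin
        σ                          ≡⟨ swap-unswap j σj≡v ⟩
        swap j (proj₂ e)           ≡⟨ cong (swap j) v≡ui ⟩
        swap j (swap i (proj₁ e))  ≡⟨ cong (λ k → swap k (swap i (proj₁ e))) (toℕ-injective j≡i) ⟩
        swap i (swap i (proj₁ e))  ≡⟨ swap-involutive i (proj₁ e) ⟩
        proj₁ e                    ∎
        where open ≡-Reasoning
    ... | no j≢i with toℕ j ℕ.≟ suc (toℕ i)
    ... | yes j≡i+1 = charged e∈ (viaSecondAbove i e∈ σ∉ σj≡v v≡ui j≡i+1)
    ... | no j≢i+1 with suc (toℕ j) ℕ.≟ toℕ i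
    ... | yes j+1≡i = charged e∈ (viaSecondBelow i e∈ σ∉ σj≡v v≡ui j+1≡i)
    ... | no j+1≢i  = charged e∈ (viaSecondFar i e∈ σ∉ σj≡v v≡ui (j≢i , j≢i+1 , j+1≢i))

    chargeUnmatched : ∀ {σ} j → IsPerm σ → ¬ Matched σ → ∃[ c ] c ∈ C × Charge (σ , j) c
    chargeUnmatched j σ-perm σ∉ with cover σ-perm j
    ... | inj₁ σ∈  = ⊥-elim (σ∉ σ∈)
    ... | inj₂ σj∈ with ∈-endpoints⁻ M σj∈
    ...   | e , e∈ , inj₁ σj≡u = charged e∈ (viaFirst e∈ σ∉ σj≡u)
    ...   | e , e∈ , inj₂ σj≡v = chargeViaSecond e∈ σ∉ σj≡v

  charge : ∀ {d} → d ∈ D → ∃[ c ] c ∈ C × Charge d c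
  charge {σ , j} d∈ with σ ∈? endpoints M
  ... | yes σ∈ = chargeMatched j σ∈
  ... | no σ∉  = chargeUnmatched j (perm∈D d∈) σ∉

  lowerBound : (n ∸ 1) * n ! ≤ (3 * n ∸ 2) * length M
  lowerBound = begin
    m * n !                                      ≡⟨ ℕ.*-comm m (n !) ⟩
    n ! * m                                      ≡⟨ cong₂ _*_ (length-permutations n) (length-allFin m) ⟨
    length (permutations n) * length (allFin m)  ≡⟨ length-cartesianProductWith _,_ (permutations n) (allFin m) ⟨
    length D                                     ≤⟨ injectiveRelation⇒length≤ Charge D-unique charge charge-functional ⟩
    length C                                     ≡⟨ length-cartesianProductWith _,_ M (slots m) ⟩
    length M * length (slots m)                  ≡⟨ cong (length M *_) (length-slots m) ⟩
    length M * suc (3 * m)                       ≡⟨ ℕ.*-comm (length M) (suc (3 * m)) ⟩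
    suc (3 * m) * length M                       ≡⟨ cong (λ k → (k ∸ 2) * length M) (ℕ.*-suc 3 m) ⟨
    (3 * n ∸ 2) * length M                       ∎
    where
    open ℕ.≤-Reasoning

    D-unique : Unique D
    D-unique = cartesianProduct⁺ (permutations-unique n) (allFin⁺ m)

-- Non-inversions and an independent set

data ℤ₃ : Set where
  0₃ 1₃ 2₃ : ℤ₃

suc₃ : ℤ₃ → ℤ₃
suc₃ 0₃ = 1₃
suc₃ 1₃ = 2₃
suc₃ 2₃ = 0₃

[_]₃ : ℕ → ℤ₃
[ zero  ]₃ = 0₃
[ suc n ]₃ = suc₃ [ n ]₃

x≢suc₃x : ∀ x → x ≢ suc₃ x
x≢suc₃x 0₃ ()
x≢suc₃x 1₃ ()
x≢suc₃x 2₃ ()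

[+]₃-congˡ : ∀ k {a b} → [ a ]₃ ≡ [ b ]₃ → [ k + a ]₃ ≡ [ k + b ]₃
[+]₃-congˡ zero    eq = eq
[+]₃-congˡ (suc k) eq = cong suc₃ ([+]₃-congˡ k eq)

indicator : ∀ {P : Set} → Dec P → ℕ
indicator (yes _) = 1
indicator (no _)  = 0

indicator-yes : ∀ {P : Set} (p? : Dec P) → P → indicator p? ≡ 1
indicator-yes (yes _) _ = refl
indicator-yes (no ¬p) p = ⊥-elim (¬p p)

indicator-no : ∀ {P : Set} (p? : Dec P) → ¬ P → indicator p? ≡ 0
indicator-no (yes p) ¬p = ⊥-elim (¬p p)
indicator-no (no _)  _  = refl

module _ {N : ℕ} where

  countBelow : Fin N → List (Fin N) → ℕ
  countBelow x []       = 0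
  countBelow x (y ∷ ys) = indicator (y <? x) + countBelow x ys

  countBelow-↭ : ∀ x {ys zs} → ys ↭ zs → countBelow x ys ≡ countBelow x zs
  countBelow-↭ x ↭.refl                          = refl
  countBelow-↭ x (↭.prep y ys↭zs)                = cong (indicator (y <? x) +_) (countBelow-↭ x ys↭zs)
  countBelow-↭ x (↭.swap {xs = ys} y z ys↭zs)    =
    trans (x∙yz≈y∙xz (indicator (y <? x)) (indicator (z <? x)) (countBelow x ys))
          (cong (λ k → indicator (z <? x) + (indicator (y <? x) + k)) (countBelow-↭ x ys↭zs))
  countBelow-↭ x (↭.trans ys↭ws ws↭zs)          = trans (countBelow-↭ x ys↭ws) (countBelow-↭ x ws↭zs)

  countBelow-mono : ∀ {a b : Fin N} ys → a <ᶠ b → countBelow a ys ≤ countBelow b ys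
  countBelow-mono []       a<b = z≤n
  countBelow-mono {a} {b} (y ∷ ys) a<b = ℕ.+-mono-≤ indicator-mono (countBelow-mono ys a<b)
    where
    indicator-mono : indicator (y <? a) ≤ indicator (y <? b)
    indicator-mono with y <? a | y <? b
    ... | no _    | _      = z≤n
    ... | yes _   | yes _  = ℕ.≤-refl
    ... | yes y<a | no y≮b = ⊥-elim (y≮b (<ᶠ-trans y<a a<b))

  countBelow-≤-length : ∀ x ys → countBelow x ys ≤ length ys
  countBelow-≤-length x []       = z≤n
  countBelow-≤-length x (y ∷ ys) with y <? x
  ... | yes _ = s≤s (countBelow-≤-length x ys)
  ... | no _  = ℕ.m≤n⇒m≤1+n (countBelow-≤-length x ys)

  -- pre lists the entries to the left of v, nearest first.
  smallerBefore : ∀ {L} → List (Fin N) → Vec (Fin N) L → List ℕ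
  smallerBefore pre []      = []
  smallerBefore pre (x ∷ v) = countBelow x pre ∷ smallerBefore (x ∷ pre) v

  smallerBefore-↭ : ∀ {L pre pre′} → pre ↭ pre′ → (v : Vec (Fin N) L) → smallerBefore pre v ≡ smallerBefore pre′ v
  smallerBefore-↭ pre↭pre′ []      = refl
  smallerBefore-↭ pre↭pre′ (x ∷ v) = cong₂ _∷_ (countBelow-↭ x pre↭pre′) (smallerBefore-↭ (↭.prep x pre↭pre′) v)

data AscentSwapped : ℕ → List ℕ → List ℕ → Set where
  here  : ∀ {A B rest} → A ≤ B → AscentSwapped 0 (A ∷ suc B ∷ rest) (B ∷ A ∷ rest)
  there : ∀ {p x c c′} → AscentSwapped p c c′ → AscentSwapped (suc p) (x ∷ c) (x ∷ c′)

AscentSwapped-sum : ∀ {p c c′} → AscentSwapped p c c′ → sum c ≡ suc (sum c′)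
AscentSwapped-sum (here {A} {B} {rest} _) = trans (ℕ.+-suc A (B + sum rest)) (cong suc (x∙yz≈y∙xz A B (sum rest)))
AscentSwapped-sum (there {x = x} s)       = trans (cong (x +_) (AscentSwapped-sum s)) (ℕ.+-suc x _)

Bounded : ℕ → List ℕ → Set
Bounded k []       = ⊤
Bounded k (c ∷ cs) = c ≤ k × Bounded (suc k) cs

module _ {N : ℕ} where

  smallerBefore-bounded : ∀ {L} (pre : List (Fin N)) (v : Vec (Fin N) L) → Bounded (length pre) (smallerBefore pre v)
  smallerBefore-bounded pre []      = tt
  smallerBefore-bounded pre (x ∷ v) = countBelow-≤-length x pre , smallerBefore-bounded (x ∷ pre) v

  smallerBefore-swap : ∀ {L} (pre : List (Fin N)) (i : Fin L) (v : Vec (Fin N) (suc L)) →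
    lookup v (inject₁ i) <ᶠ lookup v (suc i) → AscentSwapped (toℕ i) (smallerBefore pre v) (smallerBefore pre (swap i v))
  smallerBefore-swap pre zero (a ∷ b ∷ w) a<b
    rewrite indicator-yes (a <? b) a<b | indicator-no (b <? a) (<-asym a<b)
          | smallerBefore-↭ {pre = a ∷ b ∷ pre} (↭.↭-swap a b ↭.refl) w
    = here (countBelow-mono pre a<b)
  smallerBefore-swap pre (suc i) (x ∷ w) a<b = there (smallerBefore-swap (x ∷ pre) i w a<b)

hexagonPosition : ℕ → ℕ → ℕ
hexagonPosition c₁ c₂ = c₁ + indicator (c₂ ≤? c₁)

-- c₁ + c₂ counts the non-inversions among the first three entries, so for an exposed permutation the
-- remaining non-inversions are congruent to hexagonPosition c₁ c₂.
weight : List ℕ → ℕ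
weight (_ ∷ c₁ ∷ c₂ ∷ _) = c₁ + (c₂ + hexagonPosition c₁ c₂)
weight _                 = 0

ExposedCode : List ℕ → Set
ExposedCode c = [ sum c ]₃ ≡ [ weight c ]₃

Exposed : ∀ {n} → Word n → Set
Exposed σ = ExposedCode (smallerBefore [] σ)

-- A finite check on the first three (bounded) code entries; from the fourth entry on the weight is unchanged.
weight-AscentSwapped : ∀ {p c c′} → AscentSwapped p c c′ → Bounded 0 c → [ weight c ]₃ ≢ suc₃ [ weight c′ ]₃
weight-AscentSwapped (here {rest = []} _)                   _                                                         = λ ()
weight-AscentSwapped (here {rest = _ ∷ _} z≤n)              (z≤n , s≤s z≤n , z≤n , _)                                 = λ ()
weight-AscentSwapped (here {rest = _ ∷ _} z≤n)              (z≤n , s≤s z≤n , s≤s z≤n , _)                             = λ ()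
weight-AscentSwapped (here {rest = _ ∷ _} z≤n)              (z≤n , s≤s z≤n , s≤s (s≤s z≤n) , _)                       = λ ()
weight-AscentSwapped (there (here z≤n))                     (z≤n , z≤n , s≤s z≤n , _)                                 = λ ()
weight-AscentSwapped (there (here z≤n))                     (z≤n , z≤n , s≤s (s≤s z≤n) , _)                           = λ ()
weight-AscentSwapped (there (here (s≤s z≤n)))               (z≤n , s≤s z≤n , s≤s (s≤s z≤n) , _)                       = λ ()
weight-AscentSwapped (there (there (here z≤n)))             (z≤n , z≤n , z≤n , s≤s z≤n , _)                           = λ ()
weight-AscentSwapped (there (there (here z≤n)))             (z≤n , z≤n , z≤n , s≤s (s≤s z≤n) , _)                     = λ ()
weight-AscentSwapped (there (there (here z≤n)))             (z≤n , z≤n , z≤n , s≤s (s≤s (s≤s z≤n)) , _)               = λ ()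
weight-AscentSwapped (there (there (here (s≤s z≤n))))       (z≤n , z≤n , s≤s z≤n , s≤s (s≤s z≤n) , _)                 = λ ()
weight-AscentSwapped (there (there (here (s≤s z≤n))))       (z≤n , z≤n , s≤s z≤n , s≤s (s≤s (s≤s z≤n)) , _)           = λ ()
weight-AscentSwapped (there (there (here (s≤s (s≤s z≤n))))) (z≤n , z≤n , s≤s (s≤s z≤n) , s≤s (s≤s (s≤s z≤n)) , _)     = λ ()
weight-AscentSwapped (there (there (here z≤n)))             (z≤n , s≤s z≤n , z≤n , s≤s z≤n , _)                       = λ ()
weight-AscentSwapped (there (there (here z≤n)))             (z≤n , s≤s z≤n , z≤n , s≤s (s≤s z≤n) , _)                 = λ ()
weight-AscentSwapped (there (there (here z≤n)))             (z≤n , s≤s z≤n , z≤n , s≤s (s≤s (s≤s z≤n)) , _)           = λ ()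
weight-AscentSwapped (there (there (here (s≤s z≤n))))       (z≤n , s≤s z≤n , s≤s z≤n , s≤s (s≤s z≤n) , _)             = λ ()
weight-AscentSwapped (there (there (here (s≤s z≤n))))       (z≤n , s≤s z≤n , s≤s z≤n , s≤s (s≤s (s≤s z≤n)) , _)       = λ ()
weight-AscentSwapped (there (there (here (s≤s (s≤s z≤n))))) (z≤n , s≤s z≤n , s≤s (s≤s z≤n) , s≤s (s≤s (s≤s z≤n)) , _) = λ ()
weight-AscentSwapped (there (there (there _)))              _                                                         = x≢suc₃x _

ExposedCode-AscentSwapped : ∀ {p c c′} → AscentSwapped p c c′ → Bounded 0 c → ExposedCode c → ExposedCode c′ → ⊥
ExposedCode-AscentSwapped {c = c} {c′} s bounded exposed exposed′ = weight-AscentSwapped s bounded (begin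
  [ weight c ]₃        ≡⟨ exposed ⟨
  [ sum c ]₃           ≡⟨ cong [_]₃ (AscentSwapped-sum s) ⟩
  suc₃ [ sum c′ ]₃     ≡⟨ cong suc₃ exposed′ ⟩
  suc₃ [ weight c′ ]₃  ∎)
  where open ≡-Reasoning

Exposed-independent : ∀ {m} {σ : Word (suc m)} → IsPerm σ → (i : Fin m) → Exposed σ → Exposed (swap i σ) → ⊥
Exposed-independent {σ = σ} σ-perm i exposed exposed′ with <-cmp (lookup σ (inject₁ i)) (lookup σ (suc i))
... | tri< lt _ _ = ExposedCode-AscentSwapped (smallerBefore-swap [] i σ lt) (smallerBefore-bounded [] σ) exposed exposed′
... | tri≈ _ eq _ = inject₁≢suc i (σ-perm _ _ eq)
... | tri> _ _ gt = ExposedCode-AscentSwapped ascent (smallerBefore-bounded [] (swap i σ)) exposed′ exposed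
  where
  gt′ : lookup (swap i σ) (inject₁ i) <ᶠ lookup (swap i σ) (suc i)
  gt′ = subst₂ _<ᶠ_ (sym (lookup-swap-inject₁ i σ)) (sym (lookup-swap-suc i σ)) gt

  ascent : AscentSwapped (toℕ i) (smallerBefore [] (swap i σ)) (smallerBefore [] σ)
  ascent = subst (AscentSwapped (toℕ i) _) (cong (smallerBefore []) (swap-involutive i σ))
                 (smallerBefore-swap [] i (swap i σ) gt′)

-- Hexagons

data Arrangement : Set where
  abc bac bca cba cab acb : Arrangement

arrangements : List Arrangement
arrangements = abc ∷ bac ∷ bca ∷ cba ∷ cab ∷ acb ∷ []

arrangements-unique : Unique arrangements
arrangements-unique =
  ((λ ()) ∷ (λ ()) ∷ (λ ()) ∷ (λ ()) ∷ (λ ()) ∷ []) ∷ ((λ ()) ∷ (λ ()) ∷ (λ ()) ∷ (λ ()) ∷ []) ∷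
  ((λ ()) ∷ (λ ()) ∷ (λ ()) ∷ []) ∷ ((λ ()) ∷ (λ ()) ∷ []) ∷ ((λ ()) ∷ []) ∷ [] ∷ []

inverse : Arrangement → Arrangement
inverse bca = cab
inverse cab = bca
inverse r   = r

module _ {A : Set} {k : ℕ} where

  arrange : Arrangement → Vec A (3 + k) → Vec A (3 + k)
  arrange abc (a ∷ b ∷ c ∷ s) = a ∷ b ∷ c ∷ s
  arrange bac (a ∷ b ∷ c ∷ s) = b ∷ a ∷ c ∷ s
  arrange bca (a ∷ b ∷ c ∷ s) = b ∷ c ∷ a ∷ s
  arrange cba (a ∷ b ∷ c ∷ s) = c ∷ b ∷ a ∷ s
  arrange cab (a ∷ b ∷ c ∷ s) = c ∷ a ∷ b ∷ s
  arrange acb (a ∷ b ∷ c ∷ s) = a ∷ c ∷ b ∷ s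

  arrange-inverse : ∀ r (β : Vec A (3 + k)) → arrange (inverse r) (arrange r β) ≡ β
  arrange-inverse abc (_ ∷ _ ∷ _ ∷ _) = refl
  arrange-inverse bac (_ ∷ _ ∷ _ ∷ _) = refl
  arrange-inverse bca (_ ∷ _ ∷ _ ∷ _) = refl
  arrange-inverse cba (_ ∷ _ ∷ _ ∷ _) = refl
  arrange-inverse cab (_ ∷ _ ∷ _ ∷ _) = refl
  arrange-inverse acb (_ ∷ _ ∷ _ ∷ _) = refl

  arrange-injectiveʳ : ∀ r {β β′ : Vec A (3 + k)} → arrange r β ≡ arrange r β′ → β ≡ β′
  arrange-injectiveʳ r {β} {β′} eq =
    trans (sym (arrange-inverse r β)) (trans (cong (arrange (inverse r)) eq) (arrange-inverse r β′))

code₁ code₂ : Arrangement → ℕ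
code₁ abc = 1
code₁ bac = 0
code₁ bca = 1
code₁ cba = 0
code₁ cab = 0
code₁ acb = 1
code₂ abc = 2
code₂ bac = 2
code₂ bca = 0
code₂ cba = 0
code₂ cab = 1
code₂ acb = 1

fromCode : ℕ → ℕ → Arrangement
fromCode 1 2 = abc
fromCode 0 2 = bac
fromCode 1 0 = bca
fromCode 0 0 = cba
fromCode 0 1 = cab
fromCode _ _ = acb

fromCode-code : ∀ r → fromCode (code₁ r) (code₂ r) ≡ r
fromCode-code abc = refl
fromCode-code bac = refl
fromCode-code bca = refl
fromCode-code cba = refl
fromCode-code cab = refl
fromCode-code acb = refl

-- Around the hexagon abc, bac, bca, cba, cab, acb the class is 1, 0, 2, 1, 0, 2: two vertices share
-- it exactly when they are opposite.
class : Arrangement → ℤ₃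
class r = [ hexagonPosition (code₁ r) (code₂ r) ]₃

covered : ℤ₃ → List Arrangement
covered 0₃ = bca ∷ cba ∷ acb ∷ abc ∷ []
covered 1₃ = bac ∷ bca ∷ cab ∷ acb ∷ []
covered 2₃ = abc ∷ bac ∷ cba ∷ cab ∷ []

covered-unique : ∀ h → Unique (covered h)
covered-unique 0₃ = ((λ ()) ∷ (λ ()) ∷ (λ ()) ∷ []) ∷ ((λ ()) ∷ (λ ()) ∷ []) ∷ ((λ ()) ∷ []) ∷ [] ∷ []
covered-unique 1₃ = ((λ ()) ∷ (λ ()) ∷ (λ ()) ∷ []) ∷ ((λ ()) ∷ (λ ()) ∷ []) ∷ ((λ ()) ∷ []) ∷ [] ∷ []
covered-unique 2₃ = ((λ ()) ∷ (λ ()) ∷ (λ ()) ∷ []) ∷ ((λ ()) ∷ (λ ()) ∷ []) ∷ ((λ ()) ∷ []) ∷ [] ∷ []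

∈-covered : ∀ h r → class r ≢ h → r ∈ covered h
∈-covered 0₃ bca _   = here refl
∈-covered 0₃ cba _   = there (here refl)
∈-covered 0₃ acb _   = there (there (here refl))
∈-covered 0₃ abc _   = there (there (there (here refl)))
∈-covered 1₃ bac _   = here refl
∈-covered 1₃ bca _   = there (here refl)
∈-covered 1₃ cab _   = there (there (here refl))
∈-covered 1₃ acb _   = there (there (there (here refl)))
∈-covered 2₃ abc _   = here refl
∈-covered 2₃ bac _   = there (here refl)
∈-covered 2₃ cba _   = there (there (here refl))
∈-covered 2₃ cab _   = there (there (there (here refl)))
∈-covered 0₃ bac r∉ = ⊥-elim (r∉ refl)
∈-covered 0₃ cab r∉ = ⊥-elim (r∉ refl)
∈-covered 1₃ abc r∉ = ⊥-elim (r∉ refl)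
∈-covered 1₃ cba r∉ = ⊥-elim (r∉ refl)
∈-covered 2₃ bca r∉ = ⊥-elim (r∉ refl)
∈-covered 2₃ acb r∉ = ⊥-elim (r∉ refl)

module _ {k : ℕ} where

  private
    n : ℕ
    n = 3 + k

  IsPerm-arrange : ∀ r (β : Word n) → IsPerm β → IsPerm (arrange r β)
  IsPerm-arrange abc (a ∷ b ∷ c ∷ s) p = p
  IsPerm-arrange bac (a ∷ b ∷ c ∷ s) p = IsPerm-swap zero (a ∷ b ∷ c ∷ s) p
  IsPerm-arrange bca (a ∷ b ∷ c ∷ s) p = IsPerm-swap (suc zero) (b ∷ a ∷ c ∷ s) (IsPerm-swap zero (a ∷ b ∷ c ∷ s) p)
  IsPerm-arrange cba (a ∷ b ∷ c ∷ s) p =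
    IsPerm-swap zero (b ∷ c ∷ a ∷ s) (IsPerm-swap (suc zero) (b ∷ a ∷ c ∷ s) (IsPerm-swap zero (a ∷ b ∷ c ∷ s) p))
  IsPerm-arrange cab (a ∷ b ∷ c ∷ s) p = IsPerm-swap zero (a ∷ c ∷ b ∷ s) (IsPerm-swap (suc zero) (a ∷ b ∷ c ∷ s) p)
  IsPerm-arrange acb (a ∷ b ∷ c ∷ s) p = IsPerm-swap (suc zero) (a ∷ b ∷ c ∷ s) p

  IsPerm-arrange⁻ : ∀ r (β : Word n) → IsPerm (arrange r β) → IsPerm β
  IsPerm-arrange⁻ r β p = subst IsPerm (arrange-inverse r β) (IsPerm-arrange (inverse r) (arrange r β) p)

  Sorted : Word n → Set
  Sorted (a ∷ b ∷ c ∷ _) = a <ᶠ b × b <ᶠ c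

  sorted? : Decidable Sorted
  sorted? (a ∷ b ∷ c ∷ _) = (a <? b) ×-dec (b <? c)

  decompose : (σ : Word n) → IsPerm σ → ∃[ r ] ∃[ β ] Sorted β × σ ≡ arrange r β
  decompose (x ∷ y ∷ z ∷ s) σ-perm with <-cmp x y | <-cmp y z | <-cmp x z
  ... | tri≈ _ x≡y _ | _            | _            with () ← σ-perm zero (suc zero) x≡y
  ... | _            | tri≈ _ y≡z _ | _            with () ← σ-perm (suc zero) (suc (suc zero)) y≡z
  ... | _            | _            | tri≈ _ x≡z _ with () ← σ-perm zero (suc (suc zero)) x≡z
  ... | tri< x<y _ _ | tri< y<z _ _ | _            = abc , (x ∷ y ∷ z ∷ s) , (x<y , y<z) , refl
  ... | tri< x<y _ _ | tri> _ _ z<y | tri< x<z _ _ = acb , (x ∷ z ∷ y ∷ s) , (x<z , z<y) , refl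
  ... | tri< x<y _ _ | tri> _ _ z<y | tri> _ _ z<x = bca , (z ∷ x ∷ y ∷ s) , (z<x , x<y) , refl
  ... | tri> _ _ y<x | tri< y<z _ _ | tri< x<z _ _ = bac , (y ∷ x ∷ z ∷ s) , (y<x , x<z) , refl
  ... | tri> _ _ y<x | tri< y<z _ _ | tri> _ _ z<x = cab , (y ∷ z ∷ x ∷ s) , (y<z , z<x) , refl
  ... | tri> _ _ y<x | tri> _ _ z<y | _            = cba , (z ∷ y ∷ x ∷ s) , (z<y , y<x) , refl

  restCode : Word n → List ℕ
  restCode (a ∷ b ∷ c ∷ s) = smallerBefore (c ∷ b ∷ a ∷ []) s

  arrange-code : ∀ r (β : Word n) → Sorted β → smallerBefore [] (arrange r β) ≡ 0 ∷ code₁ r ∷ code₂ r ∷ restCode β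
  arrange-code abc (a ∷ b ∷ c ∷ s) (a<b , b<c)
    rewrite indicator-yes (a <? b) a<b | indicator-yes (b <? c) b<c | indicator-yes (a <? c) (<ᶠ-trans a<b b<c)
    = refl
  arrange-code bac (a ∷ b ∷ c ∷ s) (a<b , b<c)
    rewrite indicator-no (b <? a) (<-asym a<b) | indicator-yes (a <? c) (<ᶠ-trans a<b b<c) | indicator-yes (b <? c) b<c
    = cong (λ t → 0 ∷ 0 ∷ 2 ∷ t) (smallerBefore-↭ (↭.↭-prep c (↭.↭-swap a b ↭.refl)) s)
  arrange-code bca (a ∷ b ∷ c ∷ s) (a<b , b<c)
    rewrite indicator-yes (b <? c) b<c | indicator-no (c <? a) (<-asym (<ᶠ-trans a<b b<c)) | indicator-no (b <? a) (<-asym a<b)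
    = cong (λ t → 0 ∷ 1 ∷ 0 ∷ t)
        (smallerBefore-↭ (↭.↭-trans (↭.↭-swap a c ↭.refl) (↭.↭-prep c (↭.↭-swap a b ↭.refl))) s)
  arrange-code cba (a ∷ b ∷ c ∷ s) (a<b , b<c)
    rewrite indicator-no (c <? b) (<-asym b<c) | indicator-no (b <? a) (<-asym a<b)
          | indicator-no (c <? a) (<-asym (<ᶠ-trans a<b b<c))
    = cong (λ t → 0 ∷ 0 ∷ 0 ∷ t) (smallerBefore-↭ reversal s)
    where
    reversal : a ∷ b ∷ c ∷ [] ↭ c ∷ b ∷ a ∷ []
    reversal = ↭.↭-trans (↭.↭-swap a b ↭.refl) (↭.↭-trans (↭.↭-prep b (↭.↭-swap a c ↭.refl)) (↭.↭-swap b c ↭.refl))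
  arrange-code cab (a ∷ b ∷ c ∷ s) (a<b , b<c)
    rewrite indicator-no (c <? a) (<-asym (<ᶠ-trans a<b b<c)) | indicator-yes (a <? b) a<b | indicator-no (c <? b) (<-asym b<c)
    = cong (λ t → 0 ∷ 0 ∷ 1 ∷ t)
        (smallerBefore-↭ (↭.↭-trans (↭.↭-prep b (↭.↭-swap a c ↭.refl)) (↭.↭-swap b c ↭.refl)) s)
  arrange-code acb (a ∷ b ∷ c ∷ s) (a<b , b<c)
    rewrite indicator-yes (a <? c) (<ᶠ-trans a<b b<c) | indicator-no (c <? b) (<-asym b<c) | indicator-yes (a <? b) a<b
    = cong (λ t → 0 ∷ 1 ∷ 1 ∷ t) (smallerBefore-↭ (↭.↭-swap b c ↭.refl) s)

  arrange-injective : ∀ {r r′} {β β′ : Word n} → Sorted β → Sorted β′ → arrange r β ≡ arrange r′ β′ →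
    r ≡ r′ × β ≡ β′
  arrange-injective {r} {r′} {β} {β′} β-sorted β′-sorted eq =
    same-arrangement , arrange-injectiveʳ r (trans eq (cong (λ r″ → arrange r″ β′) (sym same-arrangement)))
    where
    codes : code₁ r ∷ code₂ r ∷ restCode β ≡ code₁ r′ ∷ code₂ r′ ∷ restCode β′
    codes = Listₚ.∷-injectiveʳ
      (trans (sym (arrange-code r β β-sorted)) (trans (cong (smallerBefore []) eq) (arrange-code r′ β′ β′-sorted)))

    same-arrangement : r ≡ r′
    same-arrangement = begin
      r                               ≡⟨ fromCode-code r ⟨
      fromCode (code₁ r) (code₂ r)    ≡⟨ cong₂ fromCode (Listₚ.∷-injectiveˡ codes)
                                                          (Listₚ.∷-injectiveˡ (Listₚ.∷-injectiveʳ codes)) ⟩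
      fromCode (code₁ r′) (code₂ r′)  ≡⟨ fromCode-code r′ ⟩
      r′                              ∎
      where open ≡-Reasoning

  hexagonEdges : ℤ₃ → Word n → List (Edge n)
  hexagonEdges 0₃ β = (arrange bca β , arrange cba β) ∷ (arrange acb β , arrange abc β) ∷ []
  hexagonEdges 1₃ β = (arrange bac β , arrange bca β) ∷ (arrange cab β , arrange acb β) ∷ []
  hexagonEdges 2₃ β = (arrange abc β , arrange bac β) ∷ (arrange cba β , arrange cab β) ∷ []

  endpoints-hexagonEdges : ∀ h β → endpoints (hexagonEdges h β) ≡ List.map (λ r → arrange r β) (covered h)
  endpoints-hexagonEdges 0₃ β = refl
  endpoints-hexagonEdges 1₃ β = refl
  endpoints-hexagonEdges 2₃ β = refl

  length-hexagonEdges : ∀ h β → length (hexagonEdges h β) ≡ 2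
  length-hexagonEdges 0₃ β = refl
  length-hexagonEdges 1₃ β = refl
  length-hexagonEdges 2₃ β = refl

  hexagonEdges-IsEdge : ∀ h β → IsPerm β → ∀ {e} → e ∈ hexagonEdges h β → IsEdge e
  hexagonEdges-IsEdge 0₃ β@(_ ∷ _ ∷ _ ∷ _) p (here refl)         = IsPerm-arrange bca β p , swap⇒Adj zero (arrange bca β)
  hexagonEdges-IsEdge 0₃ β@(_ ∷ _ ∷ _ ∷ _) p (there (here refl)) = IsPerm-arrange acb β p , swap⇒Adj (suc zero) (arrange acb β)
  hexagonEdges-IsEdge 1₃ β@(_ ∷ _ ∷ _ ∷ _) p (here refl)         = IsPerm-arrange bac β p , swap⇒Adj (suc zero) (arrange bac β)
  hexagonEdges-IsEdge 1₃ β@(_ ∷ _ ∷ _ ∷ _) p (there (here refl)) = IsPerm-arrange cab β p , swap⇒Adj zero (arrange cab β)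
  hexagonEdges-IsEdge 2₃ β@(_ ∷ _ ∷ _ ∷ _) p (here refl)         = IsPerm-arrange abc β p , swap⇒Adj zero (arrange abc β)
  hexagonEdges-IsEdge 2₃ β@(_ ∷ _ ∷ _ ∷ _) p (there (here refl)) = IsPerm-arrange cba β p , swap⇒Adj (suc zero) (arrange cba β)

-- Upper bound

module UpperBound (k : ℕ) where

  private
    n : ℕ
    n = 3 + k

    open import Data.List.Membership.DecPropositional (≡-dec {n = n} (_≟_ {n})) using (_∈?_)

  bases : List (Word n)
  bases = filter sorted? (permutations n)

  private
    bases-unique : Unique bases
    bases-unique = filter⁺ sorted? (permutations-unique n)

    base-perm : ∀ {β} → β ∈ bases → IsPerm β
    base-perm β∈ = ∈-permutations⁻ n (proj₁ (∈-filter⁻ sorted? {xs = permutations n} β∈))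

    base-sorted : ∀ {β} → β ∈ bases → Sorted β
    base-sorted β∈ = proj₂ (∈-filter⁻ sorted? {xs = permutations n} β∈)

  hexClass : Word n → ℤ₃
  hexClass β = [ sum (restCode β) ]₃

  baseEdges : Word n → List (Edge n)
  baseEdges β = hexagonEdges (hexClass β) β

  matching : List (Edge n)
  matching = concatMap baseEdges bases

  Exposed-arrange : ∀ r {β} → Sorted β → class r ≡ hexClass β → Exposed (arrange r β)
  Exposed-arrange r {β} sorted eq rewrite arrange-code r β sorted = [+]₃-congˡ (code₁ r) ([+]₃-congˡ (code₂ r) (sym eq))

  ∈-endpoints-baseEdges⁻ : ∀ {β σ} → σ ∈ endpoints (baseEdges β) → ∃[ r ] σ ≡ arrange r β
  ∈-endpoints-baseEdges⁻ {β} {σ} σ∈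
    with r , _ , σ≡ ← ∈-map⁻ (λ r → arrange r β) (subst (σ ∈_) (endpoints-hexagonEdges (hexClass β) β) σ∈) = r , σ≡

  ∈-endpoints-baseEdges⁺ : ∀ r {β} → class r ≢ hexClass β → arrange r β ∈ endpoints (baseEdges β)
  ∈-endpoints-baseEdges⁺ r {β} r-covered = subst (arrange r β ∈_) (sym (endpoints-hexagonEdges (hexClass β) β))
    (∈-map⁺ (λ r → arrange r β) (∈-covered (hexClass β) r r-covered))

  matching-IsEdge : ∀ e → e ∈ matching → IsEdge e
  matching-IsEdge e e∈ with β , β∈ , e∈β ← find (∈-concatMap⁻ baseEdges {xs = bases} e∈) =
    hexagonEdges-IsEdge (hexClass β) β (base-perm β∈) e∈β

  matching-unique : Unique (endpoints matching)
  matching-unique = subst Unique (sym (endpoints-concatMap baseEdges bases))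
    (Unique-concatMap (λ β → endpoints (baseEdges β)) bases-unique baseEdges-unique disjoint)
    where
    baseEdges-unique : ∀ {β} → β ∈ bases → Unique (endpoints (baseEdges β))
    baseEdges-unique {β} β∈ = subst Unique (sym (endpoints-hexagonEdges (hexClass β) β))
      (map⁺ (proj₁ ∘ arrange-injective (base-sorted β∈) (base-sorted β∈)) (covered-unique (hexClass β)))

    disjoint : ∀ {β β′ σ} → β ∈ bases → β′ ∈ bases →
      σ ∈ endpoints (baseEdges β) → σ ∈ endpoints (baseEdges β′) → β ≡ β′
    disjoint β∈ β′∈ σ∈ σ∈′
      with _ , σ≡ ← ∈-endpoints-baseEdges⁻ σ∈ | _ , σ≡′ ← ∈-endpoints-baseEdges⁻ σ∈′ =
      proj₂ (arrange-injective (base-sorted β∈) (base-sorted β′∈) (trans (sym σ≡) σ≡′))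

  matching-covers : ∀ {σ} → IsPerm σ → ¬ Exposed σ → σ ∈ endpoints matching
  matching-covers {σ} σ-perm unexposed with r , β , sorted , refl ← decompose σ σ-perm =
    subst (arrange r β ∈_) (sym (endpoints-concatMap baseEdges bases))
      (∈-concatMap⁺ (λ β → endpoints (baseEdges β)) (lose β∈ σ∈β))
    where
    σ∈β : arrange r β ∈ endpoints (baseEdges β)
    σ∈β = ∈-endpoints-baseEdges⁺ r (unexposed ∘ Exposed-arrange r sorted)

    β∈ : β ∈ bases
    β∈ = ∈-filter⁺ sorted? (∈-permutations⁺ n (IsPerm-arrange⁻ r β σ-perm)) sorted

  matching-maximal : IsMaximalMatching matching
  matching-maximal = (matching-IsEdge , matching-unique) , maximal
    where
    maximal : (e : Edge n) → IsEdge e → proj₁ e ∈ endpoints matching ⊎ proj₂ e ∈ endpoints matching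
    maximal (u , v) (u-perm , adj) with i , refl ← Adj⇒swap adj | u ∈? endpoints matching
    ... | yes u∈ = inj₁ u∈
    ... | no u∉  = inj₂ (matching-covers (IsPerm-swap i u u-perm) λ v-exposed →
                     u∉ (matching-covers u-perm λ u-exposed → Exposed-independent u-perm i u-exposed v-exposed))

  private
    pairs : List (Word n × Arrangement)
    pairs = cartesianProduct bases arrangements

    base∈ : ∀ {β r} → (β , r) ∈ pairs → β ∈ bases
    base∈ d∈ = proj₁ (∈-cartesianProduct⁻ bases arrangements d∈)

    Arranged : Word n × Arrangement → Word n → Set
    Arranged (β , r) σ = σ ≡ arrange r β

    arranged : ∀ {d} → d ∈ pairs → ∃[ σ ] σ ∈ permutations n × Arranged d σ
    arranged {β , r} d∈ = arrange r β , ∈-permutations⁺ n (IsPerm-arrange r β (base-perm (base∈ d∈))) , refl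

    arranged-functional : ∀ {d d′ σ} → d ∈ pairs → d′ ∈ pairs → Arranged d σ → Arranged d′ σ → d ≡ d′
    arranged-functional {β , r} {β′ , r′} d∈ d′∈ refl eq
      with refl , refl ← arrange-injective (base-sorted (base∈ d∈)) (base-sorted (base∈ d′∈)) eq = refl

  matching-length : 3 * length matching ≤ n !
  matching-length = begin
    3 * length matching                  ≡⟨ cong (3 *_) (length-concatMap baseEdges two-edges bases) ⟩
    3 * (2 * length bases)               ≡⟨ ℕ.*-assoc 3 2 (length bases) ⟨
    6 * length bases                     ≡⟨ ℕ.*-comm 6 (length bases) ⟩
    length bases * length arrangements   ≡⟨ length-cartesianProductWith _,_ bases arrangements ⟨
    length pairs                         ≤⟨ injectiveRelation⇒length≤ Arranged pairs-unique arranged arranged-functional ⟩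
    length (permutations n)              ≡⟨ length-permutations n ⟩
    n !                                  ∎
    where
    open ℕ.≤-Reasoning

    two-edges : ∀ β → length (baseEdges β) ≡ 2
    two-edges β = length-hexagonEdges (hexClass β) β

    pairs-unique : Unique pairs
    pairs-unique = cartesianProduct⁺ bases-unique arrangements-unique

-- Existence of the minimum

module _ {P : ℕ → Set} (P? : Decidable P) where

  private
    Least : Set
    Least = ∃[ m ] P m × (∀ {k} → P k → m ≤ k)

  least : ∀ {s} → P s → ∃[ m ] P m × (∀ {k} → P k → m ≤ k)
  least {s} = <-rec (λ s → P s → Least) search s
    where
    search : ∀ s → (∀ {k} → k < s → P k → Least) → P s → Least
    search s below ps with anyUpTo? P? s
    ... | yes (k , k<s , pk) = below k<s pk
    ... | no none            = s , ps , λ {k} pk → ≮⇒≥ (λ k<s → none (k , k<s , pk))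

listsOfLength : ∀ {A : Set} → List A → ℕ → List (List A)
listsOfLength xs zero    = [] ∷ []
listsOfLength xs (suc k) = cartesianProductWith _∷_ xs (listsOfLength xs k)

∈-listsOfLength : ∀ {A : Set} {xs : List A} {ys} → All (_∈ xs) ys → ys ∈ listsOfLength xs (length ys)
∈-listsOfLength []           = here refl
∈-listsOfLength (y∈ ∷ ys∈xs) = ∈-cartesianProductWith⁺ _∷_ y∈ (∈-listsOfLength ys∈xs)

HasMaximalMatchingOfSize : ℕ → ℕ → Set
HasMaximalMatchingOfSize n k = ∃[ M ] IsMaximalMatching {n} M × length M ≡ k

module _ {m : ℕ} where

  private
    n : ℕ
    n = suc m

    _≟ʷ_ : DecidableEquality (Word n)
    _≟ʷ_ = ≡-dec _≟_

    open import Data.List.Membership.DecPropositional _≟ʷ_ using (_∈?_)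
    open import Data.List.Relation.Unary.Unique.DecPropositional _≟ʷ_ using (unique?)

    edges : List (Edge n)
    edges = cartesianProduct (permutations n) (permutations n)

    ∈-edges : ∀ {e} → IsEdge e → e ∈ edges
    ∈-edges {u , v} (u-perm , adj) with i , refl ← Adj⇒swap adj =
      ∈-cartesianProduct⁺ (∈-permutations⁺ n u-perm) (∈-permutations⁺ n (IsPerm-swap i u u-perm))

  IsPerm? : Decidable (IsPerm {n})
  IsPerm? σ = all? λ i → all? λ j → (lookup σ i ≟ lookup σ j) →-dec (i ≟ j)

  Adj? : ∀ σ σ′ → Dec (Adj {n} σ σ′)
  Adj? σ σ′ = any? λ p → any? λ q → (toℕ q ℕ.≟ suc (toℕ p)) ×-dec (σ′ ≟ʷ swapAt p q σ)

  IsEdge? : Decidable (IsEdge {n})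
  IsEdge? (u , v) = IsPerm? u ×-dec Adj? u v

  IsMaximalMatching? : Decidable (IsMaximalMatching {n})
  IsMaximalMatching? M = (edges? ×-dec unique? (endpoints M)) ×-dec maximal?
    where
    edges? : Dec ((e : Edge n) → e ∈ M → IsEdge e)
    edges? = map′ (λ all e e∈ → All.lookup all e∈) (λ f → All.tabulate (f _)) (All.all? IsEdge? M)

    maximal? : Dec ((e : Edge n) → IsEdge e → proj₁ e ∈ endpoints M ⊎ proj₂ e ∈ endpoints M)
    maximal? = map′ (λ all e e-edge → All.lookup all (∈-edges e-edge) e-edge) (λ f → All.tabulate λ {e} _ → f e)
      (All.all? (λ e → IsEdge? e →-dec (proj₁ e ∈? endpoints M ⊎-dec proj₂ e ∈? endpoints M)) edges)

  HasMaximalMatchingOfSize? : Decidable (HasMaximalMatchingOfSize n)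
  HasMaximalMatchingOfSize? k = map′ found complete
    (Any.any? (λ M → IsMaximalMatching? M ×-dec (length M ℕ.≟ k)) (listsOfLength edges k))
    where
    found : Any.Any (λ M → IsMaximalMatching M × length M ≡ k) (listsOfLength edges k) → HasMaximalMatchingOfSize n k
    found any with M , _ , M-ok ← find any = M , M-ok

    complete : HasMaximalMatchingOfSize n k → Any.Any (λ M → IsMaximalMatching M × length M ≡ k) (listsOfLength edges k)
    complete (M , M-maximal , refl) =
      lose (∈-listsOfLength (All.tabulate λ {e} e∈ → ∈-edges (proj₁ (proj₁ M-maximal) e e∈))) (M-maximal , refl)

open UpperBound using (matching; matching-maximal; matching-length)

theorem1p1 : (n : ℕ) → 3 ≤ n →
    Σ ℕ λ m → IsMinMaximalMatchingSize n m ×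
      (((n ∸ 1) * (n !) ≤ (3 * n ∸ 2) * m) × (3 * m ≤ n !))
theorem1p1 (suc (suc (suc k))) (s≤s (s≤s (s≤s z≤n)))
  with m , (M , M-maximal , refl) , minimal ← least HasMaximalMatchingOfSize? (matching k , matching-maximal k , refl)
  = length M
  , ((M , M-maximal , refl) , λ M′ M′-maximal → minimal (M′ , M′-maximal , refl))
  , LowerBound.lowerBound M-maximal
  , ℕ.≤-trans (ℕ.*-monoʳ-≤ 3 (minimal (matching k , matching-maximal k , refl))) (matching-length k)
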